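{- Let $G$ be a finite simple graph on $n$ vertices with no ds-completable vertex. Let $i$ be a vertex set all of whose vertices have degree less than $\xi_i = n-1-|i|$, and let $h = \{u : d_u > \xi_i\}$. Suppose $$\left(\chi_{ih} + \kappa(\bar{i}, \xi_i)\right)\mu_i = m_i.$$ Let $c = i \cap B$ and $s = \{u : d_u = \xi_i\}$. Then $$\epsilon(c,h) \ge |h| + \sum_{w \in h} \max\!\left(0,\; d_w - n + |c| + 1 - \delta_c^D\right) \quad\text{and}\quad \epsilon(i,s) = |s|.$$
   Context: $V$ is the vertex set, $d_x$ the degree of $x$; for a vertex set $k$, $n_k = |k|$, $m_k = \sum_{x\in k} d_x$, $\bar{k} = V \setminus k$, $\xi_k = n-1-n_k$, and $\kappa(k,d)$ is the number of vertices of $k$ of degree $d$. $\chi_{ij} = m_j - (n-1-n_i)n_j$. $\mu_i = 1$ if $\bar{i}$ is neighbourly and $0$ otherwise, where a set $K$ is neighbourly if $\{d_u : u \notin K\} \cap \{d_u - 1 : u \in K\} = \emptyset$. A vertex is bad (dull) if $G$ contains a vertex of degree one less (more) than its degree; $B$, $D$ are the sets of bad and dull vertices. $\delta_c^D = 1$ if $c \cap D \ne \emptyset$ and $0$ otherwise. A vertex $v$ is ds-completable if, for each integer $d$, the vertices having degree $d$ in $G-v$ are either all neighbours of $v$ in $G$ or all non-neighbours. $\epsilon(a,b) = \sum_{x \in a}|N(x)\cap b|$. -}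

module Defs where

open import Data.Nat as ℕ using (ℕ; zero; suc)
open import Data.Integer as ℤ using (ℤ; +_)
open import Data.Bool using (Bool; true; false; if_then_else_; _∧_; _∨_; not)
open import Data.Fin using (Fin; zero; suc; _≟_)
open import Data.Fin.Subset using (Subset; _∈_; _∉_; ∣_∣; _∩_; ∁)
open import Data.Vec using (Vec; tabulate; lookup)
open import Data.Sum using (_⊎_)
open import Relation.Nullary using (does)
open import Relation.Binary.PropositionalEquality using (_≡_; _≢_)

record Graph (n : ℕ) : Set where
  field
    adj    : Fin n → Fin n → Bool
    sym    : ∀ x y → adj x y ≡ adj y x
    irrefl : ∀ x → adj x x ≡ false
open Graph public

sumℕ : ∀ {n} → (Fin n → ℕ) → ℕ
sumℕ {zero}  f = 0
sumℕ {suc n} f = f zero ℕ.+ sumℕ (λ x → f (suc x))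

sumℤ : ∀ {n} → (Fin n → ℤ) → ℤ
sumℤ {zero}  f = + 0
sumℤ {suc n} f = f zero ℤ.+ sumℤ (λ x → f (suc x))

anyV : ∀ {n} → (Fin n → Bool) → Bool
anyV {zero}  p = false
anyV {suc n} p = p zero ∨ anyV (λ x → p (suc x))

countV : ∀ {n} → (Fin n → Bool) → ℕ
countV p = sumℕ (λ x → if p x then 1 else 0)

⟪_⟫ : ∀ {n} → (Fin n → Bool) → Subset n
⟪ p ⟫ = tabulate p

module _ {n : ℕ} (G : Graph n) where

  N : Fin n → Subset n
  N x = ⟪ adj G x ⟫

  deg : Fin n → ℕ
  deg x = ∣ N x ∣

  m : Subset n → ℕ
  m k = sumℕ (λ x → if lookup k x then deg x else 0)

  ξ : Subset n → ℤ
  ξ k = + n ℤ.- + 1 ℤ.- + ∣ k ∣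

  κ : Subset n → ℤ → ℕ
  κ k d = countV (λ x → lookup k x ∧ does (+ deg x ℤ.≟ d))

  χ : Subset n → Subset n → ℤ
  χ i j = + m j ℤ.- ξ i ℤ.* + ∣ j ∣

  -- K is neighbourly iff {d_u : u ∉ K} ∩ {d_v - 1 : v ∈ K} = ∅,
  -- i.e. there are no u ∉ K, v ∈ K with d_u = d_v - 1 (i.e. d_u + 1 = d_v)
  neighbourly : Subset n → Bool
  neighbourly K = not (anyV (λ u → anyV (λ v →
                    not (lookup K u) ∧ lookup K v ∧ (suc (deg u) ℕ.≡ᵇ deg v))))

  μ : Subset n → ℤ
  μ i = if neighbourly (∁ i) then + 1 else + 0

  isBad : Fin n → Bool
  isBad x = anyV (λ y → suc (deg y) ℕ.≡ᵇ deg x)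

  isDull : Fin n → Bool
  isDull x = anyV (λ y → suc (deg x) ℕ.≡ᵇ deg y)

  B : Subset n
  B = ⟪ isBad ⟫

  D : Subset n
  D = ⟪ isDull ⟫

  δD : Subset n → ℤ
  δD c = if anyV (lookup (c ∩ D)) then + 1 else + 0

  ε : Subset n → Subset n → ℕ
  ε a b = sumℕ (λ x → if lookup a x then ∣ N x ∩ b ∣ else 0)

  -- degree of u in G - v (neighbours of u other than v)
  degDel : Fin n → Fin n → ℕ
  degDel v u = countV (λ y → adj G u y ∧ not (does (y ≟ v)))

  DsCompletable : Fin n → Set
  DsCompletable v = ∀ (d : ℕ) →
      (∀ u → u ≢ v → degDel v u ≡ d → adj G v u ≡ true)
    ⊎ (∀ u → u ≢ v → degDel v u ≡ d → adj G v u ≡ false)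

module Submission where

-- Write k = ξ_i = n - 1 - |i| (≥ 0 since i ≠ V) and, for w ∉ i, let E(w), F(w) count the
-- neighbours of w inside and outside i.  Only k vertices besides w lie outside i, so
-- F(w) ≤ k; call w saturated when F(w) = k.  A saturated w is not ds-completable, so it
-- has a neighbour u and a non-neighbour x with d_x + 1 = d_u; saturation puts x in i and
-- neighbourliness of ī puts u in i (ī is neighbourly: μ_i = 0 would force m_i = 0, i.e. an
-- isolated, hence ds-completable, vertex in i).  Double counting the edges at i gives
--   m_h + |s| ≤ Σ_h (E + k) + Σ_s E ≤ Σ_V E + k|h| = m_i + k|h|,
-- since d_w ≤ E(w) + k off i and E(y) ≥ 1 when d_y = k (else y would be saturated).  The
-- hypothesis makes both ends equal: every w ∈ h is saturated and ε(i,s) = Σ_s E = |s|.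
-- At a saturated w, u is a bad neighbour in c = i ∩ B and x a dull non-neighbour in i,
-- whence |N(w) ∩ c| ≥ 1 and d_w + |c| + 2 ≤ |N(w) ∩ c| + n + δ_c^D; summed over h in
-- clipped form this is the first claim.

open import Defs hiding (sym)

module Combinatorics where
  open import Data.Nat
  open import Data.Nat.Properties
  open import Data.Nat.Tactic.RingSolver using (solve-∀)
  open import Data.Bool using (Bool; true; false; if_then_else_; _∧_; _∨_; not)
  open import Data.Bool.Properties
    using (∧-zeroʳ; ∨-zeroʳ; ∧-comm; ∧-assoc; ∧-identityʳ; ¬-not; not-injective; T-≡)
    renaming (_≟_ to _≟ᵇ_)
  open import Data.Fin using (Fin; zero; suc) renaming (_≟_ to _≟ᶠ_)
  open import Data.Fin.Properties using (any?)
  open import Data.Fin.Subset using (Subset; ∣_∣; _∩_; ∁)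
  open import Data.Vec using (tabulate; lookup; []; _∷_)
  open import Data.Vec.Properties using (lookup∘tabulate; lookup-zipWith; lookup-map)
  open import Data.Product using (Σ; ∃₂; _×_; _,_; proj₁; proj₂)
  open import Data.Sum using (inj₁; inj₂)
  open import Data.Empty using (⊥; ⊥-elim)
  open import Function.Bundles using (Equivalence)
  open import Relation.Nullary using (¬_; Dec; does; yes; no; contradiction)
  open import Relation.Nullary.Decidable using (_×-dec_; ¬?)
  open import Relation.Binary.PropositionalEquality hiding ([_]; J)

  [_] : Bool → ℕ
  [ b ] = if b then 1 else 0

  sumOn : ∀ {n} → (Fin n → Bool) → (Fin n → ℕ) → ℕ
  sumOn p f = sumℕ (λ x → if p x then f x else 0)

  _⇒ᵇ_ : ∀ {n} → (Fin n → Bool) → (Fin n → Bool) → Set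
  q ⇒ᵇ p = ∀ x → q x ≡ true → p x ≡ true

  ∧-elimˡ : ∀ {a b} → a ∧ b ≡ true → a ≡ true
  ∧-elimˡ {true} _ = refl

  ∧-elimʳ : ∀ {a b} → a ∧ b ≡ true → b ≡ true
  ∧-elimʳ {true} b≡true = b≡true

  -- Swapping the outer conjuncts; with adjacency symmetry this gives double counting.
  ∧-swap-ends : ∀ a b c → a ∧ (b ∧ c) ≡ c ∧ (b ∧ a)
  ∧-swap-ends true  b true  = refl
  ∧-swap-ends true  b false = ∧-zeroʳ b
  ∧-swap-ends false b true  = sym (∧-zeroʳ b)
  ∧-swap-ends false b false = refl

  anyV-intro : ∀ {n} (p : Fin n → Bool) x → p x ≡ true → anyV p ≡ true
  anyV-intro p zero    px = cong (_∨ anyV (λ y → p (suc y))) px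
  anyV-intro p (suc x) px =
    trans (cong (p zero ∨_) (anyV-intro (λ y → p (suc y)) x px)) (∨-zeroʳ (p zero))

  anyV-false : ∀ {n} (p : Fin n → Bool) → anyV p ≡ false → ∀ x → p x ≡ false
  anyV-false p none x with p x in px
  ... | false = refl
  ... | true  = contradiction (trans (sym (anyV-intro p x px)) none) λ ()

  anyV-witness : ∀ {n} (p : Fin n → Bool) → anyV p ≡ true → Σ (Fin n) λ x → p x ≡ true
  anyV-witness {suc n} p some with p zero in p0
  ... | true  = zero , p0
  ... | false with anyV-witness (λ y → p (suc y)) some
  ...   | x , px = suc x , px

  sum-cong : ∀ {n} {f g : Fin n → ℕ} → (∀ x → f x ≡ g x) → sumℕ f ≡ sumℕ g
  sum-cong {zero}  f≡g = refl
  sum-cong {suc n} f≡g = cong₂ _+_ (f≡g zero) (sum-cong (λ x → f≡g (suc x)))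

  sum-zero : ∀ {n} → sumℕ {n} (λ _ → 0) ≡ 0
  sum-zero {zero}  = refl
  sum-zero {suc n} = sum-zero {n}

  sum-+ : ∀ {n} (f g : Fin n → ℕ) → sumℕ (λ x → f x + g x) ≡ sumℕ f + sumℕ g
  sum-+ {zero}  f g = refl
  sum-+ {suc n} f g =
    trans (cong (f zero + g zero +_) (sum-+ (λ x → f (suc x)) (λ x → g (suc x))))
          (+-assoc-comm (f zero) (g zero) _ _)
    where
    +-assoc-comm : ∀ a b c d → (a + b) + (c + d) ≡ (a + c) + (b + d)
    +-assoc-comm = solve-∀

  sum-mono : ∀ {n} {f g : Fin n → ℕ} → (∀ x → f x ≤ g x) → sumℕ f ≤ sumℕ g
  sum-mono {zero}  f≤g = z≤n
  sum-mono {suc n} f≤g = +-mono-≤ (f≤g zero) (sum-mono (λ x → f≤g (suc x)))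

  sum-tight : ∀ {n} {f g : Fin n → ℕ} → (∀ x → f x ≤ g x) → sumℕ g ≤ sumℕ f →
              ∀ x → f x ≡ g x
  sum-tight {suc n} {f} {g} f≤g g≤f zero = ≤-antisym (f≤g zero) head
    where
    head : g zero ≤ f zero
    head = +-cancelʳ-≤ _ _ _
             (≤-trans g≤f (+-monoʳ-≤ (f zero) (sum-mono (λ y → f≤g (suc y)))))
  sum-tight {suc n} {f} {g} f≤g g≤f (suc x) = sum-tight (λ y → f≤g (suc y)) tail x
    where
    tail : sumℕ (λ y → g (suc y)) ≤ sumℕ (λ y → f (suc y))
    tail = +-cancelˡ-≤ (g zero) _ _ (≤-trans g≤f (+-monoˡ-≤ _ (f≤g zero)))

  sum-swap : ∀ {k n} (f : Fin k → Fin n → ℕ) →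
             sumℕ (λ x → sumℕ (λ y → f x y)) ≡ sumℕ (λ y → sumℕ (λ x → f x y))
  sum-swap {zero}  {n} f = sym (sum-zero {n})
  sum-swap {suc k} {n} f =
    trans (cong (sumℕ (f zero) +_) (sum-swap (λ x y → f (suc x) y)))
          (sym (sum-+ (f zero) (λ y → sumℕ (λ x → f (suc x) y))))

  term≤sum : ∀ {n} (f : Fin n → ℕ) x → f x ≤ sumℕ f
  term≤sum f zero    = m≤m+n _ _
  term≤sum f (suc x) = ≤-trans (term≤sum (λ y → f (suc y)) x) (m≤n+m _ _)

  sumOn-cong : ∀ {n} (p : Fin n → Bool) {f g : Fin n → ℕ} → (∀ x → f x ≡ g x) →
               sumOn p f ≡ sumOn p g
  sumOn-cong p f≡g = sum-cong (λ x → cong (λ z → if p x then z else 0) (f≡g x))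

  sumOn-+ : ∀ {n} (p : Fin n → Bool) (f g : Fin n → ℕ) →
            sumOn p (λ x → f x + g x) ≡ sumOn p f + sumOn p g
  sumOn-+ p f g =
    trans (sum-cong split) (sum-+ (λ x → if p x then f x else 0) (λ x → if p x then g x else 0))
    where
    split : ∀ x → (if p x then f x + g x else 0) ≡ (if p x then f x else 0) + (if p x then g x else 0)
    split x with p x
    ... | true  = refl
    ... | false = refl

  sumOn-const : ∀ {n} (p : Fin n → Bool) k → sumOn p (λ _ → k) ≡ k * countV p
  sumOn-const {zero}  p k = sym (*-zeroʳ k)
  sumOn-const {suc n} p k =
    trans (cong₂ _+_ (scaled (p zero)) (sumOn-const (λ x → p (suc x)) k))
          (sym (*-distribˡ-+ k [ p zero ] _))
    where
    scaled : ∀ b → (if b then k else 0) ≡ k * [ b ]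
    scaled true  = sym (*-identityʳ k)
    scaled false = sym (*-zeroʳ k)

  if-mono : ∀ b {x y : ℕ} → (b ≡ true → x ≤ y) → (if b then x else 0) ≤ (if b then y else 0)
  if-mono true  x≤y = x≤y refl
  if-mono false x≤y = z≤n

  sumOn-mono : ∀ {n} (p : Fin n → Bool) {f g : Fin n → ℕ} → (∀ x → p x ≡ true → f x ≤ g x) →
               sumOn p f ≤ sumOn p g
  sumOn-mono p f≤g = sum-mono (λ x → if-mono (p x) (f≤g x))

  sumOn-tight : ∀ {n} (p : Fin n → Bool) {f g : Fin n → ℕ} →
                (∀ x → p x ≡ true → f x ≤ g x) → sumOn p g ≤ sumOn p f →
                ∀ x → p x ≡ true → f x ≡ g x
  sumOn-tight p {f} {g} f≤g g≤f x px =
    subst (λ b → (if b then f x else 0) ≡ (if b then g x else 0)) px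
          (sum-tight (λ y → if-mono (p y) (f≤g y)) g≤f x)

  sumOn-disjoint : ∀ {n} (p q : Fin n → Bool) (f : Fin n → ℕ) →
                   (∀ x → p x ≡ true → q x ≡ true → ⊥) → sumOn p f + sumOn q f ≤ sumℕ f
  sumOn-disjoint p q f disjoint = subst (_≤ sumℕ f) (sum-+ (λ x → if p x then f x else 0) (λ x → if q x then f x else 0))
                                   (sum-mono both)
    where
    both : ∀ x → (if p x then f x else 0) + (if q x then f x else 0) ≤ f x
    both x with p x in px | q x in qx
    ... | true  | true  = ⊥-elim (disjoint x px qx)
    ... | true  | false = ≤-reflexive (+-identityʳ (f x))
    ... | false | true  = ≤-refl
    ... | false | false = z≤n

  countV-cong : ∀ {n} {p q : Fin n → Bool} → (∀ x → p x ≡ q x) → countV p ≡ countV q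
  countV-cong p≡q = sum-cong (λ x → cong [_] (p≡q x))

  card : ∀ {n} (v : Subset n) → ∣ v ∣ ≡ countV (lookup v)
  card []          = refl
  card (true ∷ v)  = cong suc (card v)
  card (false ∷ v) = card v

  card-tabulate : ∀ {n} (p : Fin n → Bool) → ∣ tabulate p ∣ ≡ countV p
  card-tabulate p = trans (card (tabulate p)) (countV-cong (lookup∘tabulate p))

  countV-all : ∀ {n} → countV {n} (λ _ → true) ≡ n
  countV-all {zero}  = refl
  countV-all {suc n} = cong suc (countV-all {n})

  countV-split : ∀ {n} (p q : Fin n → Bool) →
                 countV p ≡ countV (λ x → p x ∧ q x) + countV (λ x → p x ∧ not (q x))
  countV-split p q = trans (sum-cong split) (sum-+ (λ x → [ p x ∧ q x ]) (λ x → [ p x ∧ not (q x) ]))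
    where
    split : ∀ x → [ p x ] ≡ [ p x ∧ q x ] + [ p x ∧ not (q x) ]
    split x with p x | q x
    ... | true  | true  = refl
    ... | true  | false = refl
    ... | false | _     = refl

  countV-at : ∀ {n} (p : Fin n → Bool) (w : Fin n) → countV (λ y → does (y ≟ᶠ w) ∧ p y) ≡ [ p w ]
  countV-at {suc n} p zero    = trans (cong ([ p zero ] +_) (sum-zero {n})) (+-identityʳ _)
  countV-at {suc n} p (suc w) = countV-at (λ y → p (suc y)) w

  countV-remove : ∀ {n} (p : Fin n → Bool) (w : Fin n) →
                  countV p ≡ countV (λ y → p y ∧ not (does (y ≟ᶠ w))) + [ p w ]
  countV-remove p w = begin
    countV p
      ≡⟨ countV-split p (λ y → does (y ≟ᶠ w)) ⟩
    countV (λ y → p y ∧ does (y ≟ᶠ w)) + others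
      ≡⟨ +-comm _ others ⟩
    others + countV (λ y → p y ∧ does (y ≟ᶠ w))
      ≡⟨ cong (others +_) (trans (countV-cong (λ y → ∧-comm (p y) _)) (countV-at p w)) ⟩
    others + [ p w ] ∎
    where
    open ≡-Reasoning
    others = countV (λ y → p y ∧ not (does (y ≟ᶠ w)))

  countV-pos : ∀ {n} (p : Fin n → Bool) x → p x ≡ true → 1 ≤ countV p
  countV-pos p x px = subst (λ b → [ b ] ≤ countV p) px (term≤sum (λ y → [ p y ]) x)

  indicator-mono : ∀ {n} {p q : Fin n → Bool} → q ⇒ᵇ p → ∀ x → [ q x ] ≤ [ p x ]
  indicator-mono {p = p} {q} q⇒p x with q x in qx
  ... | true  = ≤-reflexive (cong [_] (sym (q⇒p x qx)))
  ... | false = z≤n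

  countV-mono : ∀ {n} {p q : Fin n → Bool} → q ⇒ᵇ p → countV q ≤ countV p
  countV-mono q⇒p = sum-mono (indicator-mono q⇒p)

  countV-tight : ∀ {n} {p q : Fin n → Bool} → q ⇒ᵇ p → countV p ≤ countV q → p ⇒ᵇ q
  countV-tight {p = p} {q} q⇒p p≤q x px with q x | sum-tight (indicator-mono q⇒p) p≤q x
  ... | true  | _       = refl
  ... | false | 0≡[px] = contradiction (trans 0≡[px] (cong [_] px)) λ ()

  countV-strict : ∀ {n} {p q : Fin n → Bool} → q ⇒ᵇ p → ∀ x → p x ≡ true → q x ≡ false →
                  suc (countV q) ≤ countV p
  countV-strict {p = p} {q} q⇒p x px qx with countV p ≤? countV q
  ... | yes p≤q = contradiction (trans (sym qx) (countV-tight q⇒p p≤q x px)) λ ()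
  ... | no  p≰q = ≰⇒> p≰q

  squeeze : ∀ {a b c d} → a ≤ b → c ≤ d → b + d ≤ a + c → b ≤ a × d ≤ c
  squeeze {a} {b} {c} {d} a≤b c≤d b+d≤a+c =
      +-cancelʳ-≤ d b a (≤-trans b+d≤a+c (+-monoʳ-≤ a c≤d))
    , +-cancelˡ-≤ b d c (≤-trans b+d≤a+c (+-monoˡ-≤ c a≤b))

  module GraphCounting {n : ℕ} (G : Graph n) where

    nbrs : Fin n → (Fin n → Bool) → ℕ
    nbrs w p = countV (λ y → adj G w y ∧ p y)

    nbrs-⇒ : ∀ w p → (λ y → adj G w y ∧ p y) ⇒ᵇ p
    nbrs-⇒ w p y wy = ∧-elimʳ {adj G w y} wy

    deg-count : ∀ w → deg G w ≡ countV (adj G w)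
    deg-count w = card-tabulate (adj G w)

    nbrs-∩ : ∀ w (b : Subset n) → ∣ N G w ∩ b ∣ ≡ nbrs w (lookup b)
    nbrs-∩ w b = trans (card (N G w ∩ b)) (countV-cong λ y →
      trans (lookup-zipWith _∧_ y (N G w) b) (cong (_∧ lookup b y) (lookup∘tabulate (adj G w) y)))

    deg-split : ∀ w (q : Fin n → Bool) → deg G w ≡ nbrs w q + nbrs w (λ y → not (q y))
    deg-split w q = trans (deg-count w) (countV-split (adj G w) q)

    edges : (Fin n → Bool) → (Fin n → Bool) → ℕ
    edges p q = sumOn p (λ x → nbrs x q)

    edges-sym : ∀ p q → edges p q ≡ edges q p
    edges-sym p q = begin
      edges p q                                           ≡⟨ sum-cong (λ x → restrict (p x) _) ⟩
      sumℕ (λ x → countV (λ y → p x ∧ (adj G x y ∧ q y))) ≡⟨ sum-swap (λ x y → [ p x ∧ (adj G x y ∧ q y) ]) ⟩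
      sumℕ (λ y → countV (λ x → p x ∧ (adj G x y ∧ q y))) ≡⟨ sum-cong (λ y → countV-cong (λ x → turn x y)) ⟩
      sumℕ (λ y → countV (λ x → q y ∧ (adj G y x ∧ p x))) ≡⟨ sum-cong (λ y → restrict (q y) _) ⟨
      edges q p                                           ∎
      where
      open ≡-Reasoning
      restrict : ∀ b (r : Fin n → Bool) → (if b then countV r else 0) ≡ countV (λ y → b ∧ r y)
      restrict true  r = refl
      restrict false r = sym (sum-zero {n})
      turn : ∀ x y → p x ∧ (adj G x y ∧ q y) ≡ q y ∧ (adj G y x ∧ p x)
      turn x y = trans (cong (λ a → p x ∧ (a ∧ q y)) (Graph.sym G x y)) (∧-swap-ends (p x) _ (q y))

    ε-edges : ∀ (a b : Subset n) → ε G a b ≡ edges (lookup a) (lookup b)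
    ε-edges a b = sumOn-cong (lookup a) (λ x → nbrs-∩ x b)

    m-edges : ∀ (a : Subset n) → m G a ≡ edges (lookup a) (λ _ → true)
    m-edges a = sumOn-cong (lookup a) (λ x → trans (deg-count x) (countV-cong {p = adj G x} (λ y → sym (∧-identityʳ _))))

    deg-delete : ∀ v u → deg G u ≡ degDel G v u + [ adj G v u ]
    deg-delete v u = trans (deg-count u)
      (trans (countV-remove (adj G u) v) (cong (λ b → degDel G v u + [ b ]) (Graph.sym G u v)))

    Step : Fin n → Set
    Step v = ∃₂ λ u x → adj G v u ≡ true × adj G v x ≡ false × x ≢ v × suc (deg G x) ≡ deg G u

    step? : ∀ v → Dec (Step v)
    step? v = any? λ u → any? λ x →
      (adj G v u ≟ᵇ true) ×-dec (adj G v x ≟ᵇ false) ×-dec ¬? (x ≟ᶠ v) ×-dec (suc (deg G x) ≟ deg G u)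

    -- Without a degree step, the neighbours and non-neighbours of v never share a
    -- degree in G - v, i.e. v is ds-completable.
    degree-step : ∀ v → ¬ DsCompletable G v → Step v
    degree-step v ¬ds with step? v
    ... | yes st = st
    ... | no ¬st = ⊥-elim (¬ds completable)
      where
      completable : DsCompletable G v
      completable d with any? (λ u → ¬? (u ≟ᶠ v) ×-dec (degDel G v u ≟ d) ×-dec (adj G v u ≟ᵇ true))
      ... | no none = inj₂ λ u u≢v du → ¬-not (λ vu → none (u , u≢v , du , vu))
      ... | yes (u , u≢v , du , vu) = inj₁ λ x x≢v dx →
            ¬-not (λ vx → ¬st (u , x , vu , vx , x≢v , levels x dx vx))
        where
        levels : ∀ x → degDel G v x ≡ d → adj G v x ≡ false → suc (deg G x) ≡ deg G u
        levels x dx vx = begin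
          suc (deg G x)                          ≡⟨ cong suc (deg-delete v x) ⟩
          suc (degDel G v x + [ adj G v x ])     ≡⟨ cong₂ (λ a b → suc (a + [ b ])) dx vx ⟩
          suc (d + 0)                            ≡⟨ cong suc (+-identityʳ d) ⟩
          suc d                                  ≡⟨ +-comm 1 d ⟩
          d + 1                                  ≡⟨ cong₂ (λ a b → a + [ b ]) du vu ⟨
          degDel G v u + [ adj G v u ]           ≡⟨ deg-delete v u ⟨
          deg G u                                ∎
          where open ≡-Reasoning

    -- An isolated vertex is trivially ds-completable, so a non-completable vertex has a neighbour.
    positive-degree : ∀ v → ¬ DsCompletable G v → 1 ≤ deg G v
    positive-degree v ¬ds = n≢0⇒n>0 λ d≡0 → ¬ds λ _ → inj₂ λ u _ _ → isolated d≡0 u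
      where
      isolated : deg G v ≡ 0 → ∀ u → adj G v u ≡ false
      isolated d≡0 u with adj G v u in vu
      ... | false = refl
      ... | true  = contradiction (subst (1 ≤_) (trans (sym (deg-count v)) d≡0) (countV-pos (adj G v) u vu)) λ ()

    gap : Subset n → Fin n → Fin n → Bool
    gap K u v = not (lookup K u) ∧ lookup K v ∧ (suc (deg G u) ≡ᵇ deg G v)

    neighbourly-sound : ∀ K → neighbourly G K ≡ true →
      ∀ u v → lookup K u ≡ false → lookup K v ≡ true → suc (deg G u) ≢ deg G v
    neighbourly-sound K nb u v u∉K v∈K step =
      contradiction (trans (sym nb) (cong not (anyV-intro _ u (anyV-intro (gap K u) v hit)))) λ ()
      where
      hit : gap K u v ≡ true
      hit rewrite u∉K | v∈K = Equivalence.to T-≡ (≡⇒≡ᵇ _ _ step)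

    gap-true : ∀ K u v → gap K u v ≡ true →
      lookup K u ≡ false × lookup K v ≡ true × suc (deg G u) ≡ deg G v
    gap-true K u v hit with lookup K u | lookup K v
    ... | false | true = refl , refl , ≡ᵇ⇒≡ _ _ (Equivalence.from T-≡ hit)
    gap-true K u v () | false | false
    gap-true K u v () | true  | _

    not-neighbourly : ∀ K → neighbourly G K ≡ false →
      ∃₂ λ u v → lookup K u ≡ false × lookup K v ≡ true × suc (deg G u) ≡ deg G v
    not-neighbourly K nn with anyV-witness (λ u → anyV (gap K u)) (not-injective {y = true} nn)
    ... | u , some with anyV-witness (gap K u) some
    ...   | v , hit = u , v , gap-true K u v hit

    complement-sound : ∀ i → neighbourly G (∁ i) ≡ true →
      ∀ u v → lookup i u ≡ true → lookup i v ≡ false → suc (deg G u) ≢ deg G v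
    complement-sound i nb u v u∈i v∉i = neighbourly-sound (∁ i) nb u v
      (trans (lookup-map u not i) (cong not u∈i)) (trans (lookup-map v not i) (cong not v∉i))

    -- The case μ_i = 0 cannot balance: a vertex of i (outside ∁ i) has positive degree.
    positive-volume : (∀ v → ¬ DsCompletable G v) → ∀ i → neighbourly G (∁ i) ≡ false → 1 ≤ m G i
    positive-volume noDS i nn with not-neighbourly (∁ i) nn
    ... | u , _ , u∉∁i , _ , _ =
      ≤-trans (positive-degree u (noDS u))
              (subst (λ b → (if b then deg G u else 0) ≤ m G i) u∈i
                     (term≤sum (λ x → if lookup i x then deg G x else 0) u))
      where
      u∈i : lookup i u ≡ true
      u∈i = not-injective {y = true} (trans (sym (lookup-map u not i)) u∉∁i)

  -- The analysis of one set i, with k = ξ_i = n - 1 - |i| ≥ 0, in a graph without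
  -- ds-completable vertices, where every vertex of i has degree < k and no u ∈ i,
  -- v ∉ i satisfy d_u + 1 = d_v (the complement of i is neighbourly).
  module Core {n : ℕ} (G : Graph n) (i : Subset n) (k : ℕ)
    (size      : k + suc ∣ i ∣ ≡ n)
    (noDS      : ∀ v → ¬ DsCompletable G v)
    (small     : ∀ x → lookup i x ≡ true → suc (deg G x) ≤ k)
    (separated : ∀ u v → lookup i u ≡ true → lookup i v ≡ false → suc (deg G u) ≢ deg G v)
    where
    open GraphCounting G

    I : Fin n → Bool
    I = lookup i

    E F : Fin n → ℕ
    E w = nbrs w I
    F w = nbrs w (λ y → not (I y))

    outside : ∀ y → k ≤ deg G y → I y ≡ false
    outside y k≤d with I y in y∈i
    ... | false = refl
    ... | true  = ⊥-elim (<-irrefl refl (≤-trans (small y y∈i) k≤d))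

    Other : Fin n → Fin n → Bool
    Other w y = not (I y) ∧ not (does (y ≟ᶠ w))

    others : ∀ w → I w ≡ false → countV (Other w) ≡ k
    others w w∉i = +-cancelʳ-≡ (suc ∣ i ∣) _ _ (begin
      countV (Other w) + suc ∣ i ∣                    ≡⟨ rearrange ∣ i ∣ (countV (Other w)) ⟩
      ∣ i ∣ + (countV (Other w) + [ not false ])       ≡⟨ cong₂ (λ a b → a + (countV (Other w) + [ not b ])) (sym (card i)) w∉i ⟨
      countV I + (countV (Other w) + [ not (I w) ])   ≡⟨ cong (countV I +_) (countV-remove (λ y → not (I y)) w) ⟨
      countV I + countV (λ y → not (I y))              ≡⟨ countV-split (λ _ → true) I ⟨
      countV {n} (λ _ → true)                          ≡⟨ countV-all ⟩
      n                                                ≡⟨ size ⟨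
      k + suc ∣ i ∣                                    ∎)
      where
      open ≡-Reasoning
      rearrange : ∀ a b → b + suc a ≡ a + (b + 1)
      rearrange = solve-∀

    outer-nbr-other : ∀ w → (λ y → adj G w y ∧ not (I y)) ⇒ᵇ Other w
    outer-nbr-other w y wy with y ≟ᶠ w
    ... | yes refl = contradiction (trans (sym (∧-elimˡ wy)) (Graph.irrefl G y)) λ ()
    ... | no  _    = trans (∧-identityʳ _) (∧-elimʳ wy)

    F≤k : ∀ w → I w ≡ false → F w ≤ k
    F≤k w w∉i = subst (F w ≤_) (others w w∉i) (countV-mono (outer-nbr-other w))

    saturated-adjacent : ∀ w → I w ≡ false → F w ≡ k →
                         ∀ y → I y ≡ false → y ≢ w → adj G w y ≡ true
    saturated-adjacent w w∉i full y y∉i y≢w =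
      ∧-elimˡ (countV-tight (outer-nbr-other w) (≤-reflexive (trans (others w w∉i) (sym full))) y other)
      where
      other : not (I y) ∧ not (does (y ≟ᶠ w)) ≡ true
      other rewrite y∉i with y ≟ᶠ w
      ... | yes y≡w = contradiction y≡w y≢w
      ... | no  _   = refl

    record InnerStep (w : Fin n) : Set where
      field
        up low : Fin n
        up∈i   : I up ≡ true
        low∈i  : I low ≡ true
        w~up   : adj G w up ≡ true
        w≁low  : adj G w low ≡ false
        step   : suc (deg G low) ≡ deg G up

    -- A saturated vertex has a degree step (it is not ds-completable); the non-neighbour
    -- must lie in i by saturation, and then the neighbour lies in i by separation.
    saturated-step : ∀ w → I w ≡ false → F w ≡ k → InnerStep w
    saturated-step w w∉i full with degree-step w (noDS w)
    ... | u , x , w~u , w≁x , x≢w , step = record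
      { up = u ; low = x ; up∈i = u∈i ; low∈i = x∈i ; w~up = w~u ; w≁low = w≁x ; step = step }
      where
      x∈i : I x ≡ true
      x∈i with I x in x-in
      ... | true  = refl
      ... | false = contradiction (trans (sym (saturated-adjacent w w∉i full x x-in x≢w)) w≁x) λ ()
      u∈i : I u ≡ true
      u∈i with I u in u-in
      ... | true  = refl
      ... | false = ⊥-elim (separated x u x∈i u-in step)

    -- A vertex of degree k has a neighbour in i: otherwise it would be saturated,
    -- and the upper end of its degree step is such a neighbour.
    level-has-inner-nbr : ∀ y → deg G y ≡ k → 1 ≤ E y
    level-has-inner-nbr y d≡k = n≢0⇒n>0 λ E≡0 →
      let full : F y ≡ k
          full = trans (sym (trans (deg-split y I) (cong (_+ F y) E≡0))) d≡k
          open InnerStep (saturated-step y (outside y (≤-reflexive (sym d≡k))) full)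
      in contradiction (subst (1 ≤_) E≡0 (countV-pos (λ z → adj G y z ∧ I z) up (cong₂ _∧_ w~up up∈i)))
                       λ ()

    outer-degree : ∀ w → I w ≡ false → deg G w ≤ E w + k
    outer-degree w w∉i = subst (_≤ E w + k) (sym (deg-split w I)) (+-monoʳ-≤ (E w) (F≤k w w∉i))

    -- Double counting for a set h of vertices of degree > k and a set s of vertices of
    -- degree k under the balance m_h + |s| = m_i + k|h|:  m_h ≤ Σ_h (E + k) and
    -- |s| ≤ Σ_s E, while Σ_h (E + k) + Σ_s E ≤ Σ_V E + k|h| = m_i + k|h|.
    -- Hence both inequalities are equalities.
    module Balance (h s : Subset n)
      (heavier : ∀ y → lookup h y ≡ true → k < deg G y)
      (exact   : ∀ y → lookup s y ≡ true → deg G y ≡ k)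
      (balance : m G h + ∣ s ∣ ≡ m G i + k * ∣ h ∣)
      where
      H S : Fin n → Bool
      H = lookup h
      S = lookup s

      high-degree : ∀ y → H y ≡ true → deg G y ≤ E y + k
      high-degree y y∈h = outer-degree y (outside y (<⇒≤ (heavier y y∈h)))

      h-bound : m G h ≤ sumOn H (λ y → E y + k)
      h-bound = sumOn-mono H high-degree

      s-bound : ∣ s ∣ ≤ sumOn S E
      s-bound = subst (_≤ sumOn S E) (sym (card s))
                      (sumOn-mono S λ y y∈s → level-has-inner-nbr y (exact y y∈s))

      reversed : sumOn H (λ y → E y + k) + sumOn S E ≤ m G h + ∣ s ∣
      reversed = begin
        sumOn H (λ y → E y + k) + sumOn S E      ≡⟨ cong (_+ sumOn S E) (sumOn-+ H E (λ _ → k)) ⟩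
        sumOn H E + sumOn H (λ _ → k) + sumOn S E ≡⟨ cong (λ z → sumOn H E + z + sumOn S E) constant ⟩
        sumOn H E + k * ∣ h ∣ + sumOn S E        ≡⟨ +-assoc (sumOn H E) _ _ ⟩
        sumOn H E + (k * ∣ h ∣ + sumOn S E)      ≡⟨ cong (sumOn H E +_) (+-comm (k * ∣ h ∣) _) ⟩
        sumOn H E + (sumOn S E + k * ∣ h ∣)      ≡⟨ +-assoc (sumOn H E) _ _ ⟨
        sumOn H E + sumOn S E + k * ∣ h ∣        ≤⟨ +-monoˡ-≤ _ (sumOn-disjoint H S E disjoint) ⟩
        sumℕ E + k * ∣ h ∣                       ≡⟨ cong (_+ k * ∣ h ∣) volume ⟨
        m G i + k * ∣ h ∣                         ≡⟨ balance ⟨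
        m G h + ∣ s ∣                             ∎
        where
        open ≤-Reasoning
        constant : sumOn H (λ _ → k) ≡ k * ∣ h ∣
        constant = trans (sumOn-const H k) (cong (k *_) (sym (card h)))
        disjoint : ∀ y → H y ≡ true → S y ≡ true → ⊥
        disjoint y y∈h y∈s = <-irrefl (sym (exact y y∈s)) (heavier y y∈h)
        -- m_i counts the edges leaving i, i.e. the edges entering i: Σ_V E.
        volume : m G i ≡ sumℕ E
        volume = trans (m-edges i) (edges-sym I (λ _ → true))

      tight : sumOn H (λ y → E y + k) ≤ m G h × sumOn S E ≤ ∣ s ∣
      tight = squeeze h-bound s-bound reversed

      h-saturated : ∀ w → H w ≡ true → F w ≡ k
      h-saturated w w∈h = +-cancelˡ-≡ (E w) _ _
        (trans (sym (deg-split w I)) (sumOn-tight H high-degree (proj₁ tight) w w∈h))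

      ε-level : ε G i s ≡ ∣ s ∣
      ε-level = trans (ε-edges i s) (trans (edges-sym I S) (≤-antisym (proj₂ tight) s-bound))

    c : Subset n
    c = i ∩ B G

    δ : ℕ
    δ = [ anyV (lookup (c ∩ D G)) ]

    c-member : ∀ y → lookup c y ≡ I y ∧ isBad G y
    c-member y = trans (lookup-zipWith _∧_ y i (B G)) (cong (I y ∧_) (lookup∘tabulate (isBad G) y))

    J : Fin n → Bool
    J y = I y ∧ not (isBad G y)

    split-i : ∣ i ∣ ≡ countV (lookup c) + countV J
    split-i = trans (card i) (trans (countV-split I (isBad G))
                (cong (_+ countV J) (countV-cong (λ y → sym (c-member y)))))

    split-E : ∀ w → E w ≡ nbrs w (lookup c) + nbrs w J
    split-E w = trans (countV-split (λ y → adj G w y ∧ I y) (isBad G)) (cong₂ _+_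
      (countV-cong (λ y → trans (∧-assoc (adj G w y) _ _) (cong (adj G w y ∧_) (sym (c-member y)))))
      (countV-cong (λ y → ∧-assoc (adj G w y) _ _)))

    -- At a saturated w the step (low, up) yields a bad neighbour up ∈ c and a dull
    -- non-neighbour low ∈ i; unless c meets D, low is not bad, so w misses a vertex of J.
    module Saturated (w : Fin n) (w∉i : I w ≡ false) (full : F w ≡ k) where
      open InnerStep (saturated-step w w∉i full)

      up-bad : isBad G up ≡ true
      up-bad = anyV-intro (λ y → suc (deg G y) ≡ᵇ deg G up) low (Equivalence.to T-≡ (≡⇒≡ᵇ _ _ step))

      low-dull : isDull G low ≡ true
      low-dull = anyV-intro (λ y → suc (deg G low) ≡ᵇ deg G y) up (Equivalence.to T-≡ (≡⇒≡ᵇ _ _ step))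

      has-bad-nbr : 1 ≤ nbrs w (lookup c)
      has-bad-nbr = countV-pos (λ y → adj G w y ∧ lookup c y) up
        (trans (cong (adj G w up ∧_) (c-member up)) (cong₂ _∧_ w~up (cong₂ _∧_ up∈i up-bad)))

      nonbad-gap : ∀ b → anyV (lookup (c ∩ D G)) ≡ b → nbrs w J + 1 ≤ countV J + [ b ]
      nonbad-gap true  _     = +-monoˡ-≤ 1 (countV-mono {p = J} (nbrs-⇒ w J))
      nonbad-gap false clean = subst₂ _≤_ (+-comm 1 _) (sym (+-identityʳ _))
        (countV-strict {p = J} (nbrs-⇒ w J) low low∈J (cong (_∧ J low) w≁low))
        where
        low-not-bad : isBad G low ≡ false
        low-not-bad with isBad G low in bad
        ... | false = refl
        ... | true  = trans (sym meets) (anyV-false (lookup (c ∩ D G)) clean low)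
          where
          meets : lookup (c ∩ D G) low ≡ true
          meets = trans (lookup-zipWith _∧_ low c (D G))
            (cong₂ _∧_ (trans (c-member low) (cong₂ _∧_ low∈i bad))
                       (trans (lookup∘tabulate (isDull G) low) low-dull))
        low∈J : J low ≡ true
        low∈J rewrite low∈i | low-not-bad = refl

      bound : deg G w + ∣ c ∣ + 2 ≤ nbrs w (lookup c) + n + δ
      bound = begin
        deg G w + ∣ c ∣ + 2            ≡⟨ cong₂ (λ d a → d + a + 2) degree (card c) ⟩
        e₁ + e₂ + k + a₁ + 2           ≡⟨ rearrange₁ e₁ e₂ k a₁ ⟩
        (e₂ + 1) + (e₁ + k + a₁ + 1)   ≤⟨ +-monoˡ-≤ _ (nonbad-gap _ refl) ⟩
        (a₂ + δ) + (e₁ + k + a₁ + 1)   ≡⟨ rearrange₂ e₁ k a₁ a₂ δ ⟩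
        e₁ + (k + suc (a₁ + a₂)) + δ   ≡⟨ cong (λ a → e₁ + (k + suc a) + δ) split-i ⟨
        e₁ + (k + suc ∣ i ∣) + δ       ≡⟨ cong (λ z → e₁ + z + δ) size ⟩
        e₁ + n + δ                     ∎
        where
        open ≤-Reasoning
        e₁ = nbrs w (lookup c)
        e₂ = nbrs w J
        a₁ = countV (lookup c)
        a₂ = countV J
        degree : deg G w ≡ e₁ + e₂ + k
        degree = trans (deg-split w I) (cong₂ _+_ (split-E w) full)
        rearrange₁ : ∀ a b c d → a + b + c + d + 2 ≡ (b + 1) + (a + c + d + 1)
        rearrange₁ = solve-∀
        rearrange₂ : ∀ a b c d e → (d + e) + (a + b + c + 1) ≡ a + (b + suc (c + d)) + e
        rearrange₂ = solve-∀

open Combinatorics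
open import Data.Nat using (ℕ)
open import Data.Integer using (ℤ; +_; _+_; _-_; _*_; _<_; _≤_; _⊔_)
open import Data.Bool using (if_then_else_; not)
open import Data.Fin using (Fin)
open import Data.Fin.Subset using (Subset; _∈_; ∣_∣; _∩_; ∁)
open import Data.Vec using (lookup)
open import Data.Product using (_×_)
open import Relation.Nullary using (¬_; does)
open import Relation.Binary.PropositionalEquality using (_≡_)
open import Data.Integer using (_<?_; _≟_)

import Data.Nat as ℕ
import Data.Nat.Properties as ℕP
import Data.Integer.Properties
open import Data.Integer using (-_; +≤+)
open import Data.Integer.Properties
  using (+-injective; pos-*; *-identityʳ; *-zeroʳ; m-n≡m⊖n; ⊖-≥; drop‿+<+; +-monoʳ-<; +-monoˡ-≤;
         +-mono-≤; ≤-trans; ≤-reflexive; ≤-total; <-irrefl; i≤j⇒i⊔j≡j; i≥j⇒i⊔j≡i)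
open import Data.Integer.Tactic.RingSolver using (solve-∀)
open import Data.Bool using (Bool; true; false; _∧_)
open import Data.Bool.Properties using (∧-zeroʳ; ∧-identityʳ)
open import Data.Fin using (zero; suc)
open import Data.Fin.Subset.Properties using (∣p∣≤n; ∣p∣≡n⇒p≡⊤; ∈⊤)
open import Data.Vec.Properties using (lookup∘tabulate; lookup-map; lookup⇒[]=)
open import Data.Product using (_,_)
open import Data.Sum using (inj₁; inj₂)
open import Data.Empty using (⊥-elim)
open import Relation.Nullary using (Dec; yes; no; contradiction)
open import Relation.Binary.PropositionalEquality using (refl; sym; trans; cong; subst; subst₂; module ≡-Reasoning)

does-true : ∀ {P : Set} (d : Dec P) → does d ≡ true → P
does-true (yes p) _ = p

heavy : ∀ {n} → Graph n → Subset n → Subset n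
heavy G i = ⟪ (λ u → does (ξ G i <? + deg G u)) ⟫

level : ∀ {n} → Graph n → Subset n → Subset n
level G i = ⟪ (λ u → does (+ deg G u ≟ ξ G i)) ⟫

heavy-member : ∀ {n} (G : Graph n) i {k} → ξ G i ≡ + k →
               ∀ y → lookup (heavy G i) y ≡ true → k ℕ.< deg G y
heavy-member G i ξ≡k y member = drop‿+<+ (subst (_< + deg G y) ξ≡k
  (does-true (ξ G i <? + deg G y) (trans (sym (lookup∘tabulate _ y)) member)))

level-member : ∀ {n} (G : Graph n) i {k} → ξ G i ≡ + k →
               ∀ y → lookup (level G i) y ≡ true → deg G y ≡ k
level-member G i ξ≡k y member = +-injective (trans
  (does-true (+ deg G y ≟ ξ G i) (trans (sym (lookup∘tabulate _ y)) member)) ξ≡k)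

below-difference : ∀ {d a b} → + d < + a - + b → b ℕ.+ d ℕ.< a
below-difference {d} {a} {b} d<a-b = drop‿+<+ (subst (+ (b ℕ.+ d) <_) (cancel (+ b) (+ a)) (+-monoʳ-< (+ b) d<a-b))
  where
  cancel : ∀ B A → B + (A - B) ≡ A
  cancel = solve-∀

-- Since vertices of i have degree < ξ_i, i is not all of V, so ξ_i = n - 1 - |i| ≥ 0.
inner-size : ∀ {n'} (G : Graph (ℕ.suc n')) (i : Subset (ℕ.suc n')) →
             (∀ x → x ∈ i → + deg G x < ξ G i) → ∣ i ∣ ℕ.≤ n'
inner-size {n'} G i small with ∣ i ∣ ℕ.≤? n'
... | yes fits = fits
... | no  ¬fits = ℕP.≤-trans (ℕP.m≤m+n _ _) (ℕP.<⇒≤ (below-difference (small zero zero∈i)))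
  where
  zero∈i : zero ∈ i
  zero∈i = subst (zero ∈_) (sym (∣p∣≡n⇒p≡⊤ (ℕP.≤-antisym (∣p∣≤n i) (ℕP.≰⇒> ¬fits)))) ∈⊤

ξ-value : ∀ {n'} (G : Graph (ℕ.suc n')) (i : Subset (ℕ.suc n')) →
          ∣ i ∣ ℕ.≤ n' → ξ G i ≡ + (n' ℕ.∸ ∣ i ∣)
ξ-value {n'} G i fits = trans (m-n≡m⊖n n' ∣ i ∣) (⊖-≥ fits)

-- The hypothesis forces μ_i = 1: if ∁ i were not neighbourly then μ_i = 0 and m_i = 0,
-- whereas i contains a vertex with a neighbour.
complement-neighbourly : ∀ {n} (G : Graph n) → (∀ v → ¬ DsCompletable G v) →
  ∀ i X → X * μ G i ≡ + m G i → neighbourly G (∁ i) ≡ true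
complement-neighbourly G noDS i X balanced with neighbourly G (∁ i) in nb
... | true  = refl
... | false = contradiction (subst (1 ℕ.≤_) volume-zero (GraphCounting.positive-volume G noDS i nb)) λ ()
  where
  volume-zero : m G i ≡ 0
  volume-zero = +-injective (trans (sym balanced) (*-zeroʳ X))

-- Vertices of degree ξ_i lie outside i, so κ(ī, ξ_i) = |s|.
κ-level : ∀ {n} (G : Graph n) i → (∀ x → x ∈ i → + deg G x < ξ G i) →
          κ G (∁ i) (ξ G i) ≡ ∣ level G i ∣
κ-level G i small = trans (countV-cong at-level) (sym (card-tabulate (λ u → does (+ deg G u ≟ ξ G i))))
  where
  at-level : ∀ x → lookup (∁ i) x ∧ does (+ deg G x ≟ ξ G i) ≡ does (+ deg G x ≟ ξ G i)
  at-level x with + deg G x ≟ ξ G i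
  ... | no  _    = ∧-zeroʳ _
  ... | yes d≡ξ = trans (∧-identityʳ _) (trans (lookup-map x not i) outside)
    where
    outside : not (lookup i x) ≡ true
    outside with lookup i x in x∈i
    ... | false = refl
    ... | true  = ⊥-elim (<-irrefl d≡ξ (small x (lookup⇒[]= x i x∈i)))

balance-hypothesis : ∀ {n} (G : Graph n) i {k} → ξ G i ≡ + k →
  (∀ x → x ∈ i → + deg G x < ξ G i) → neighbourly G (∁ i) ≡ true →
  (χ G i (heavy G i) + + κ G (∁ i) (ξ G i)) * μ G i ≡ + m G i →
  m G (heavy G i) ℕ.+ ∣ level G i ∣ ≡ m G i ℕ.+ k ℕ.* ∣ heavy G i ∣
balance-hypothesis G i {k} ξ≡k small nb hyp = +-injective (begin
  + mh + + S                            ≡⟨ regroup (+ mh) (+ K) (+ S) ⟩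
  (+ mh - + K + + S) + + K               ≡⟨ cong (λ z → + mh - z + + S + + K) weight ⟨
  (+ mh - ξ G i * + ∣ h ∣ + + S) + + K    ≡⟨⟩
  (χ G i h + + S) + + K                  ≡⟨ cong (λ z → χ G i h + + z + + K) (κ-level G i small) ⟨
  (χ G i h + + κ G (∁ i) (ξ G i)) + + K  ≡⟨ cong (_+ + K) (*-identityʳ lhs) ⟨
  lhs * + 1 + + K                        ≡⟨ cong (λ z → lhs * z + + K) (cong (λ b → if b then + 1 else + 0) nb) ⟨
  lhs * μ G i + + K                      ≡⟨ cong (_+ + K) hyp ⟩
  + m G i + + K                          ∎)
  where
  open ≡-Reasoning
  h = heavy G i
  mh = m G h
  S = ∣ level G i ∣
  K = k ℕ.* ∣ h ∣
  lhs = χ G i h + + κ G (∁ i) (ξ G i)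
  weight : ξ G i * + ∣ h ∣ ≡ + K
  weight = trans (cong (_* + ∣ h ∣) ξ≡k) (sym (pos-* k ∣ h ∣))
  regroup : ∀ a b c → a + c ≡ (a - b + c) + b
  regroup = solve-∀

clipped-step : ∀ {d c n δ g} → 1 ℕ.≤ g → d ℕ.+ c ℕ.+ 2 ℕ.≤ g ℕ.+ n ℕ.+ δ →
               + 1 + (+ 0 ⊔ (+ d - + n + + c + + 1 - + δ)) ≤ + g
clipped-step {d} {c} {n} {δ} {g} positive room with ≤-total (+ 0) (+ d - + n + + c + + 1 - + δ)
... | inj₂ clipped rewrite i≥j⇒i⊔j≡i clipped = +≤+ positive
... | inj₁ excess  rewrite i≤j⇒i⊔j≡j excess  = begin
  + 1 + (+ d - + n + + c + + 1 - + δ)      ≡⟨ regroup (+ d) (+ n) (+ c) (+ δ) ⟩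
  + (d ℕ.+ c ℕ.+ 2) - + (n ℕ.+ δ)           ≤⟨ +-monoˡ-≤ (- + (n ℕ.+ δ)) (+≤+ (subst (d ℕ.+ c ℕ.+ 2 ℕ.≤_) (ℕP.+-assoc g n δ) room)) ⟩
  + (g ℕ.+ (n ℕ.+ δ)) - + (n ℕ.+ δ)         ≡⟨ cancel (+ g) (+ (n ℕ.+ δ)) ⟩
  + g                                       ∎
  where
  open Data.Integer.Properties.≤-Reasoning
  regroup : ∀ D N C Δ → + 1 + (D - N + C + + 1 - Δ) ≡ (D + C + + 2) - (N + Δ)
  regroup = solve-∀
  cancel : ∀ A B → A + B - B ≡ A
  cancel = solve-∀

clipped-sum : ∀ {n} (p : Fin n → Bool) (f : Fin n → ℤ) (g : Fin n → ℕ.ℕ) →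
  (∀ w → p w ≡ true → + 1 + f w ≤ + g w) →
  + countV p + sumℤ (λ w → if p w then f w else + 0) ≤ + sumOn p g
clipped-sum {ℕ.zero}  p f g pointwise = +≤+ ℕ.z≤n
clipped-sum {ℕ.suc n} p f g pointwise = begin
  + countV p + sumℤ (λ w → if p w then f w else + 0)
    ≡⟨ interchange (+ [ p zero ]) (+ countV (λ x → p (suc x))) (if p zero then f zero else + 0) _ ⟩
  (+ [ p zero ] + (if p zero then f zero else + 0)) + (+ countV (λ x → p (suc x)) + sumℤ (λ x → if p (suc x) then f (suc x) else + 0))
    ≤⟨ +-mono-≤ head (clipped-sum (λ x → p (suc x)) (λ x → f (suc x)) (λ x → g (suc x)) (λ x → pointwise (suc x))) ⟩
  + sumOn p g ∎
  where
  open Data.Integer.Properties.≤-Reasoning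
  interchange : ∀ a b c d → (a + b) + (c + d) ≡ (a + c) + (b + d)
  interchange = solve-∀
  head : + [ p zero ] + (if p zero then f zero else + 0) ≤ + (if p zero then g zero else 0)
  head with p zero in p0
  ... | true  = pointwise zero p0
  ... | false = +≤+ ℕ.z≤n

δD-value : ∀ {n} (G : Graph n) c → δD G c ≡ + [ anyV (lookup (c ∩ D G)) ]
δD-value G c with anyV (lookup (c ∩ D G))
... | true  = refl
... | false = refl

lemma10 : ∀ {n : ℕ} (G : Graph n) →
    (∀ v → ¬ DsCompletable G v) →
    (i : Subset n) →
    (∀ x → x ∈ i → + deg G x < ξ G i) →
    (χ G i ⟪ (λ u → does (ξ G i <? + deg G u)) ⟫ + + κ G (∁ i) (ξ G i)) * μ G i ≡ + m G i →
    let h = ⟪ (λ u → does (ξ G i <? + deg G u)) ⟫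
        c = i ∩ B G
        s = ⟪ (λ u → does (+ deg G u ≟ ξ G i)) ⟫
    in (+ ∣ h ∣ + sumℤ (λ w → if lookup h w
            then (+ 0 ⊔ (+ deg G w - + n + + ∣ c ∣ + + 1 - δD G c))
            else + 0)
          ≤ + ε G c h)
       × ε G i s ≡ ∣ s ∣
lemma10 {ℕ.zero}   G _    i _     _   = +≤+ ℕ.z≤n , refl
lemma10 {ℕ.suc n'} G noDS i small hyp = heavy-bound , ε-level
  where
  fits : ∣ i ∣ ℕ.≤ n'
  fits = inner-size G i small
  k : ℕ
  k = n' ℕ.∸ ∣ i ∣
  ξ≡k : ξ G i ≡ + k
  ξ≡k = ξ-value G i fits
  nb : neighbourly G (∁ i) ≡ true
  nb = complement-neighbourly G noDS i (χ G i (heavy G i) + + κ G (∁ i) (ξ G i)) hyp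
  open Core G i k (trans (ℕP.+-suc k ∣ i ∣) (cong ℕ.suc (ℕP.m∸n+n≡m fits))) noDS
            (λ x x∈i → drop‿+<+ (subst (+ deg G x <_) ξ≡k (small x (lookup⇒[]= x i x∈i))))
            (GraphCounting.complement-sound G i nb)
  open Balance (heavy G i) (level G i) (heavy-member G i ξ≡k) (level-member G i ξ≡k)
               (balance-hypothesis G i ξ≡k small nb hyp)
  excess : Fin (ℕ.suc n') → ℤ
  excess w = + 0 ⊔ (+ deg G w - + ℕ.suc n' + + ∣ c ∣ + + 1 - δD G c)
  -- Each w ∈ h is saturated, so the bad-neighbour bound applies to it.
  pointwise : ∀ w → H w ≡ true → + 1 + excess w ≤ + GraphCounting.nbrs G w (lookup c)
  pointwise w w∈h rewrite δD-value G c = clipped-step {deg G w} {∣ c ∣} has-bad-nbr bound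
    where open Saturated w (outside w (ℕP.<⇒≤ (heavy-member G i ξ≡k w w∈h))) (h-saturated w w∈h)
  heavy-bound : + ∣ heavy G i ∣ + sumℤ (λ w → if H w then excess w else + 0) ≤ + ε G c (heavy G i)
  heavy-bound = subst₂ (λ a b → + a + sumℤ (λ w → if H w then excess w else + 0) ≤ + b)
    (sym (card (heavy G i)))
    (sym (trans (GraphCounting.ε-edges G c (heavy G i)) (GraphCounting.edges-sym G (lookup c) H)))
    (clipped-sum H excess (λ w → GraphCounting.nbrs G w (lookup c)) pointwise)
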